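{- For all cathoristic models $\mathfrak{M}$ and $\mathfrak{M}'$: (1) $\mathfrak{M}' \preceq \mathfrak{M}$ if and only if $\mathrm{Th}(\mathfrak{M}) \subseteq \mathrm{Th}(\mathfrak{M}')$; (2) $\mathfrak{M}' \simeq \mathfrak{M}$ if and only if $\mathrm{Th}(\mathfrak{M}) = \mathrm{Th}(\mathfrak{M}')$.
   Context: Fix a non-empty set $\Sigma$ of actions. Formulae of cathoristic logic are given by $\phi ::= \top \mid \phi \land \psi \mid \langle a\rangle \phi \mid\ !A$, where $a\in\Sigma$ and $A$ ranges over finite subsets of $\Sigma$. A cathoristic transition system is a triple $\mathcal{L}=(S,\rightarrow,\lambda)$ where $S$ is a set of states, $\rightarrow\subseteq S\times\Sigma\times S$ is deterministic ($s\xrightarrow{a}t$ and $s\xrightarrow{a}t'$ imply $t=t'$), and $\lambda$ maps each state to a subset of $\Sigma$, such that (admissibility) $\{a \mid \exists t.\, s\xrightarrow{a}t\}\subseteq\lambda(s)$ for every $s$, and (well-sizedness) every $\lambda(s)$ is either finite or equal to $\Sigma$. A cathoristic model is a pair $(\mathcal{L},s)$ with $s\in S$ (the start state). Satisfaction: $(\mathcal{L},s)\models\top$ always; $(\mathcal{L},s)\models\phi\land\psi$ iff both conjuncts hold; $(\mathcal{L},s)\models\langle a\rangle\phi$ iff there is $t$ with $s\xrightarrow{a}t$ and $(\mathcal{L},t)\models\phi$; $(\mathcal{L},s)\models\ !A$ iff $\lambda(s)\subseteq A$. The theory of a model is $\mathrm{Th}(\mathfrak{M})=\{\phi \mid \mathfrak{M}\models\phi\}$.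 For cathoristic transition systems $\mathcal{L}_i=(S_i,\rightarrow_i,\lambda_i)$, a simulation from $\mathcal{L}_1$ to $\mathcal{L}_2$ is a relation $R\subseteq S_1\times S_2$ such that whenever $(x,y)\in R$ and $x\xrightarrow{a}_1 x'$ there is $y'$ with $y\xrightarrow{a}_2 y'$ and $(x',y')\in R$, and moreover $\lambda_1(x)\supseteq\lambda_2(y)$ for all $(x,y)\in R$. A simulation from the model $(\mathcal{L}_1,s_1)$ to $(\mathcal{L}_2,s_2)$ is such an $R$ with $(s_1,s_2)\in R$. Write $\mathfrak{M}_1\preceq_{sim}\mathfrak{M}_2$ if there is a simulation from $\mathfrak{M}_1$ to $\mathfrak{M}_2$; define $\mathfrak{M}\preceq\mathfrak{M}'$ iff $\mathfrak{M}'\preceq_{sim}\mathfrak{M}$, and $\mathfrak{M}\simeq\mathfrak{M}'$ iff $\mathfrak{M}\preceq\mathfrak{M}'$ and $\mathfrak{M}'\preceq\mathfrak{M}$. -}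

module Defs where

open import Data.List using (List)
open import Data.List.Membership.Propositional using (_∈_)
open import Data.Product using (Σ; ∃; _×_; _,_)
open import Data.Sum using (_⊎_)
open import Relation.Binary.PropositionalEquality using (_≡_)
open import Function.Bundles using (_⇔_)

module _ {Act : Set} where

  -- Formulae of cathoristic logic; a finite set A ⊆ Act is given by a list.
  data Formula : Set where
    ⊤′   : Formula
    _∧′_ : Formula → Formula → Formula
    ⟨_⟩_ : Act → Formula → Formula
    !_   : List Act → Formula

  Subset : Set₁
  Subset = Act → Set

  _⊆ˢ_ : Subset → Subset → Set
  P ⊆ˢ Q = ∀ a → P a → Q a

  FiniteSubset : Subset → Set
  FiniteSubset P = ∃ λ (l : List Act) → ∀ a → P a ⇔ (a ∈ l)

  FullSubset : Subset → Set
  FullSubset P = ∀ a → P a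

  record CTS : Set₁ where
    field
      State         : Set
      _⟶⟨_⟩_         : State → Act → State → Set
      label         : State → Subset
      deterministic : ∀ {s a t t′} → s ⟶⟨ a ⟩ t → s ⟶⟨ a ⟩ t′ → t ≡ t′
      admissible    : ∀ s a t → s ⟶⟨ a ⟩ t → label s a
      wellSized     : ∀ s → FiniteSubset (label s) ⊎ FullSubset (label s)

  record Model : Set₁ where
    field
      lts   : CTS
      start : CTS.State lts

  open CTS

  sat : (L : CTS) → State L → Formula → Set
  sat L s ⊤′ = Data.Unit.⊤ where import Data.Unit
  sat L s (φ ∧′ ψ) = sat L s φ × sat L s ψ
  sat L s (⟨ a ⟩ φ) = ∃ λ t → (_⟶⟨_⟩_ L s a t) × sat L t φ
  sat L s (! A) = label L s ⊆ˢ (λ a → a ∈ A)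

  _⊨_ : Model → Formula → Set
  M ⊨ φ = sat (Model.lts M) (Model.start M) φ

  Th : Model → Formula → Set
  Th M φ = M ⊨ φ

  _⊆Th_ : (Formula → Set) → (Formula → Set) → Set
  T ⊆Th T′ = ∀ φ → T φ → T′ φ

  _≡Th_ : (Formula → Set) → (Formula → Set) → Set
  T ≡Th T′ = (T ⊆Th T′) × (T′ ⊆Th T)

  record IsSimulation (L₁ L₂ : CTS) (R : State L₁ → State L₂ → Set) : Set where
    field
      step  : ∀ {x y a x′} → R x y → _⟶⟨_⟩_ L₁ x a x′ →
              ∃ λ y′ → (_⟶⟨_⟩_ L₂ y a y′) × R x′ y′
      label⊇ : ∀ {x y} → R x y → label L₂ y ⊆ˢ label L₁ x

  _⪯sim_ : Model → Model → Set₁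
  M₁ ⪯sim M₂ = Σ (State (Model.lts M₁) → State (Model.lts M₂) → Set) λ R →
                 IsSimulation (Model.lts M₁) (Model.lts M₂) R
                 × R (Model.start M₁) (Model.start M₂)

  _⪯_ : Model → Model → Set₁
  M ⪯ M′ = M′ ⪯sim M

  _≃_ : Model → Model → Set₁
  M ≃ M′ = (M ⪯ M′) × (M′ ⪯ M)

-- The proof follows the usual Hennessy–Milner pattern, in two directions.
--   * Soundness: a simulation R from L₁ to L₂ transports satisfaction of
--     every formula from x to y whenever R x y (induction on formulae; the
--     label condition λ₁(x) ⊇ λ₂(y) is exactly what  ! A  needs).
--   * Completeness: the relation "every formula true at x is true at y"
--     is itself a simulation.  Transitions are matched using ⟨a⟩⊤ together
--     with determinism of L₂; the label condition uses well-sizedness of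
--     L₁: if λ₁(x) is finite, the formula  ! λ₁(x)  holds at x, hence at y,
--     and if λ₁(x) = Σ there is nothing to show.

module Submission where

open import Defs
open import Data.Product using (∃; _×_; _,_)
open import Data.Product.Function.NonDependent.Propositional using (_×-⇔_)
open import Data.Sum using (inj₁; inj₂)
open import Data.Unit using (tt)
open import Function.Bundles using (_⇔_; mk⇔; Equivalence)
open import Relation.Binary.PropositionalEquality using (subst)

module _ {Act : Set} where
  open CTS

  simulation-preserves-sat : {L₁ L₂ : CTS {Act}} {R : State L₁ → State L₂ → Set} →
    IsSimulation L₁ L₂ R → ∀ {x y} → R x y → ∀ φ → sat L₁ x φ → sat L₂ y φ
  simulation-preserves-sat S r ⊤′ _ = tt
  simulation-preserves-sat S r (φ ∧′ ψ) (sφ , sψ) =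
    simulation-preserves-sat S r φ sφ , simulation-preserves-sat S r ψ sψ
  simulation-preserves-sat S r (⟨ a ⟩ φ) (x′ , x→x′ , sφ)
    with IsSimulation.step S r x→x′
  ... | y′ , y→y′ , r′ = y′ , y→y′ , simulation-preserves-sat S r′ φ sφ
  simulation-preserves-sat S r (! A) λx⊆A b λy-b =
    λx⊆A b (IsSimulation.label⊇ S r b λy-b)

  ThIncl : (L₁ L₂ : CTS {Act}) → State L₁ → State L₂ → Set
  ThIncl L₁ L₂ x y = ∀ φ → sat L₁ x φ → sat L₂ y φ

  -- In a deterministic system the a-successor is unique, so a formula ⟨a⟩φ
  -- true at y forces φ at any given a-successor of y.
  diamond-at-successor : (L : CTS {Act}) {y y′ : State L} {a : Act} →
    _⟶⟨_⟩_ L y a y′ → ∀ φ → sat L y (⟨ a ⟩ φ) → sat L y′ φ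
  diamond-at-successor L y→y′ φ (y″ , y→y″ , sφ) =
    subst (λ z → sat L z φ) (deterministic L y→y″ y→y′) sφ

  ThIncl-step : (L₁ L₂ : CTS {Act}) → ∀ {x y a x′} → ThIncl L₁ L₂ x y →
    _⟶⟨_⟩_ L₁ x a x′ → ∃ λ y′ → (_⟶⟨_⟩_ L₂ y a y′) × ThIncl L₁ L₂ x′ y′
  ThIncl-step L₁ L₂ {a = a} {x′} incl x→x′
    with incl (⟨ a ⟩ ⊤′) (x′ , x→x′ , tt)
  ... | y′ , y→y′ , _ =
    y′ , y→y′ , λ φ sφ → diamond-at-successor L₂ y→y′ φ (incl (⟨ a ⟩ φ) (x′ , x→x′ , sφ))

  -- Theory inclusion forces the reverse inclusion of labels; the finite case
  -- uses the formula ! l, where the list l enumerates λ₁(x).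
  ThIncl-label : (L₁ L₂ : CTS {Act}) → ∀ {x y} → ThIncl L₁ L₂ x y →
    label L₂ y ⊆ˢ label L₁ x
  ThIncl-label L₁ L₂ {x} incl b λy-b with wellSized L₁ x
  ... | inj₂ full = full b
  ... | inj₁ (l , λx⇔l) =
    Equivalence.from (λx⇔l b)
      (incl (! l) (λ c λx-c → Equivalence.to (λx⇔l c) λx-c) b λy-b)

  ThIncl-simulation : (L₁ L₂ : CTS {Act}) → IsSimulation L₁ L₂ (ThIncl L₁ L₂)
  ThIncl-simulation L₁ L₂ = record
    { step   = ThIncl-step L₁ L₂
    ; label⊇ = ThIncl-label L₁ L₂
    }

  ⪯⇔Th⊆ : (M M′ : Model {Act}) → (M′ ⪯ M) ⇔ (Th M ⊆Th Th M′)
  ⪯⇔Th⊆ M M′ = mk⇔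
    (λ { (_ , S , r) → simulation-preserves-sat S r })
    (λ incl → ThIncl L L′ , ThIncl-simulation L L′ , incl)
    where
    L  = Model.lts M
    L′ = Model.lts M′

mainTheorem1 : (Act : Set) → Act → (M M′ : Model {Act}) →
    ((M′ ⪯ M) ⇔ (Th M ⊆Th Th M′)) × ((M′ ≃ M) ⇔ (Th M ≡Th Th M′))
mainTheorem1 _ _ M M′ = ⪯⇔Th⊆ M M′ , (⪯⇔Th⊆ M M′ ×-⇔ ⪯⇔Th⊆ M′ M)
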